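{- Let $p$ be a prime, $q=p^k$, and let $P(x_1,\dots,x_p)$ be the polynomial $\big(\sum_{I\subseteq[p-1]}(-1)^{|I|+1}(x_I+x_p)^{q-1}\big)/(x_1\cdots x_{p-1})$ over $\mathbb{F}_q$. Then the support of $P$ (the set of $x\in\mathbb{F}_q^p$ with $P(x)\ne0$) has size at most $(2^{p-1}+p-1)q^{p-1}$ and is contained in $$\Big(\bigcup_{i=1}^{p-1}\{x: x_i=0\}\Big)\cup\Big(\bigcup_{I\subseteq[p-1]}\{x: x_I+x_p=0\}\Big).$$
   Context: $x_I=\sum_{i\in I}x_i$ (with $x_\emptyset=0$); the division defining $P$ is an exact polynomial division, and $P$ is evaluated as a polynomial. -}

module Defs where

open import Level using (0ℓ)
open import Algebra.Bundles using (CommutativeRing)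
open import Data.Nat as ℕ using (ℕ; zero; suc; _∸_; _<ᵇ_)
open import Data.Bool using (Bool; true; false; if_then_else_)
open import Data.Fin using (Fin; zero; suc; toℕ; inject₁; fromℕ)
open import Data.Vec using (Vec; []; _∷_)
open import Data.List using (List; []; _∷_; _++_; map; concatMap; foldr; upTo; length; filter)
open import Data.Product using (Σ; _,_)
open import Relation.Nullary using (¬_)
open import Relation.Nullary.Decidable using (¬?)
open import Relation.Binary using (Decidable)
open import Relation.Binary.PropositionalEquality using (_≡_)

record FiniteField (q : ℕ) : Set₁ where
  field
    cring : CommutativeRing 0ℓ 0ℓ
  open CommutativeRing cring public hiding (zero)
  field
    0≉1      : ¬ (0# ≈ 1#)
    inverse  : ∀ x → ¬ (x ≈ 0#) → Σ Carrier (λ y → x * y ≈ 1#)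
    _≟_      : Decidable _≈_
    elem     : Fin q → Carrier
    elem-inj : ∀ i j → elem i ≈ elem j → i ≡ j
    elem-sur : ∀ x → Σ (Fin q) (λ i → elem i ≈ x)

Exp : ℕ → Set
Exp n = Fin n → ℕ

cons : ∀ {n} → ℕ → Exp n → Exp (suc n)
cons a e zero    = a
cons a e (suc i) = e i

below : (n : ℕ) → Exp n → List (Exp n)
below zero    e = (λ ()) ∷ []
below (suc n) e =
  concatMap (λ a → map (cons a) (below n (λ i → e (suc i)))) (upTo (suc (e zero)))

eqExp : (n : ℕ) → Exp n → Exp n → Bool
eqExp zero    e f = true
eqExp (suc n) e f with e zero ℕ.≟ f zero
... | Relation.Nullary.yes _ = eqExp n (λ i → e (suc i)) (λ i → f (suc i))
... | Relation.Nullary.no  _ = false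

unitExp : ∀ {n} → Fin n → Exp n
unitExp i j with toℕ i ℕ.≟ toℕ j
... | Relation.Nullary.yes _ = 1
... | Relation.Nullary.no  _ = 0

-- subsets of [m] as characteristic vectors
allSubsets : (m : ℕ) → List (Vec Bool m)
allSubsets zero    = [] ∷ []
allSubsets (suc m) = map (true ∷_) (allSubsets m) ++ map (false ∷_) (allSubsets m)

card : ∀ {m} → Vec Bool m → ℕ
card []           = 0
card (true ∷ I)  = suc (card I)
card (false ∷ I) = card I

even : ℕ → Bool
even zero          = true
even (suc zero)    = false
even (suc (suc n)) = even n

consF : ∀ {n q} → Fin q → (Fin n → Fin q) → Fin (suc n) → Fin q
consF a v zero    = a
consF a v (suc i) = v i

allFuns : (n q : ℕ) → List (Fin n → Fin q)
allFuns zero    q = (λ ()) ∷ []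
allFuns (suc n) q = concatMap (λ a → map (consF a) (allFuns n q)) (Data.List.allFin q)

module Polynomials (R : CommutativeRing 0ℓ 0ℓ) where
  open CommutativeRing R hiding (zero)

  Σᴸ : List Carrier → Carrier
  Σᴸ = foldr _+_ 0#

  _^ᴿ_ : Carrier → ℕ → Carrier
  x ^ᴿ zero  = 1#
  x ^ᴿ suc n = x * (x ^ᴿ n)

  Poly : ℕ → Set
  Poly n = Exp n → Carrier

  0ₚ : ∀ {n} → Poly n
  0ₚ e = 0#

  1ₚ : ∀ {n} → Poly n
  1ₚ {n} e = if eqExp n e (λ _ → 0) then 1# else 0#

  X : ∀ {n} → Fin n → Poly n
  X {n} i e = if eqExp n e (unitExp i) then 1# else 0#

  _+ₚ_ : ∀ {n} → Poly n → Poly n → Poly n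
  (f +ₚ g) e = f e + g e

  -ₚ_ : ∀ {n} → Poly n → Poly n
  (-ₚ f) e = - f e

  _*ₚ_ : ∀ {n} → Poly n → Poly n → Poly n
  _*ₚ_ {n} f g e = Σᴸ (map (λ a → f a * g (λ i → e i ∸ a i)) (below n e))

  _^ₚ_ : ∀ {n} → Poly n → ℕ → Poly n
  f ^ₚ zero  = 1ₚ
  f ^ₚ suc k = f *ₚ (f ^ₚ k)

  Σₚ : ∀ {n} → List (Poly n) → Poly n
  Σₚ = foldr _+ₚ_ 0ₚ

  mono : ∀ {n} → (Fin n → Carrier) → Exp n → Carrier
  mono {zero}  x e = 1#
  mono {suc n} x e = (x zero ^ᴿ e zero) * mono (λ i → x (suc i)) (λ i → e (suc i))

  -- evaluation of a polynomial all of whose monomials have every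
  -- exponent ≤ B  (this holds for the P below with B = q)
  evalB : ∀ {n} → ℕ → Poly n → (Fin n → Carrier) → Carrier
  evalB {n} B f x = Σᴸ (map (λ e → f e * mono x e) (below n (λ _ → B)))

  -- The polynomial of the lemma, in the p = suc m variables
  -- x_1..x_{p-1} = X (inject₁ i) (i : Fin m) and x_p = X (fromℕ m).

  sumSel : ∀ {k n} → Vec Bool k → (Fin k → Poly n) → Poly n
  sumSel []           f = 0ₚ
  sumSel (true ∷ I)  f = f zero +ₚ sumSel I (λ i → f (suc i))
  sumSel (false ∷ I) f = sumSel I (λ i → f (suc i))

  xI+xp : (m : ℕ) → Vec Bool m → Poly (suc m)
  xI+xp m I = sumSel I (λ i → X (inject₁ i)) +ₚ X (fromℕ m)

  signed : ∀ {k n} → Vec Bool k → Poly n → Poly n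
  signed I f = if even (card I) then -ₚ f else f

  numer : (m q : ℕ) → Poly (suc m)
  numer m q = Σₚ (map (λ I → signed I (xI+xp m I ^ₚ (q ∸ 1))) (allSubsets m))

  -- exact division by the monomial x_1 ⋯ x_{p-1}:
  -- coefficient of x^e in the quotient = coefficient of x^e·x_1⋯x_{p-1}
  shiftExp : (m : ℕ) → Exp (suc m) → Exp (suc m)
  shiftExp m e j = e j ℕ.+ (if toℕ j <ᵇ m then 1 else 0)

  P : (m q : ℕ) → Poly (suc m)
  P m q e = numer m q (shiftExp m e)

module _ {q : ℕ} (F : FiniteField q) where
  open FiniteField F
  open Polynomials cring

  P-at : (m : ℕ) → (Fin (suc m) → Carrier) → Carrier
  P-at m x = evalB q (P m q) x

  sumSelR : ∀ {k} → Vec Bool k → (Fin k → Carrier) → Carrier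
  sumSelR []           f = 0#
  sumSelR (true ∷ I)  f = f zero + sumSelR I (λ i → f (suc i))
  sumSelR (false ∷ I) f = sumSelR I (λ i → f (suc i))

  xI+xp-at : (m : ℕ) → Vec Bool m → (Fin (suc m) → Carrier) → Carrier
  xI+xp-at m I x = sumSelR I (λ i → x (inject₁ i)) + x (fromℕ m)

  supportSize : (m : ℕ) → ℕ
  supportSize m = length (filter (λ v → ¬? (P-at m (λ j → elem (v j)) ≟ 0#)) (allFuns (suc m) q))

module Submission where

-- Let x have all xᵢ (i < p) and all x_I + x_p nonzero. Since y^(q-1) = 1 for y ≠ 0, the numerator
-- evaluates to Σ_I (-1)^(|I|+1) = 0 there. Zeroing a coordinate xᵢ turns each x_I + x_p into
-- x_{I∖{i}} + x_p, so the same holds at every point obtained from x by zeroing coordinates, and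
-- inclusion–exclusion over the coordinates x₁ … x_{p-1} isolates the monomials divisible by
-- x₁⋯x_{p-1}, whose sum is P(x)·x₁⋯x_{p-1}. Hence P(x) = 0, so the support lies on the p - 1 + 2^(p-1)
-- hyperplanes, each of which has q^(p-1) points because it determines one coordinate from the others.

open import Level using (0ℓ)
open import Defs
open import Data.Nat as ℕ using (ℕ; zero; suc; _≤_; _<_; z≤n; s≤s)
import Data.Nat.Properties as ℕ
open import Data.Fin as Fin using (Fin; zero; suc; toℕ; inject₁; fromℕ)
import Data.Fin.Properties as Fin
import Data.List.Properties as List
open import Data.Vec as Vec using (Vec; []; _∷_)
open import Data.List as List using (List; []; _∷_; _++_; map; concatMap; upTo; applyUpTo; allFin; length; filter)
open import Data.List.Relation.Unary.Any as Any using (Any; here; there)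
import Data.List.Relation.Unary.Any.Properties as Any
open import Data.List.Membership.Propositional.Properties using (∈-allFin)
open import Data.Bool as Bool using (Bool; true; false; if_then_else_; _∧_; T)
import Data.Bool.Properties as Bool
open import Data.Empty using (⊥; ⊥-elim)
open import Data.Product using (Σ; _,_; _×_; proj₁; proj₂)
open import Data.Sum using (_⊎_; inj₁; inj₂)
open import Data.Unit using (tt)
open import Function using (_∘_)
open import Relation.Binary.PropositionalEquality as ≡ using (_≡_; _≢_; _≗_; cong; cong₂)
open import Relation.Nullary using (¬_; yes; no; Dec; does; ¬?)
open import Algebra.Bundles using (CommutativeRing)
import Algebra.Properties.CommutativeMonoid.Sum as MonoidSum

T-ext : ∀ {b b′ : Bool} → (T b → T b′) → (T b′ → T b) → b ≡ b′
T-ext {true}  {true}  _ _ = ≡.refl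
T-ext {true}  {false} f _ = ⊥-elim (f tt)
T-ext {false} {true}  _ g = ⊥-elim (g tt)
T-ext {false} {false} _ _ = ≡.refl

≡true⇒T : ∀ {b} → b ≡ true → T b
≡true⇒T ≡.refl = tt

T⇒≡true : ∀ {b} → T b → b ≡ true
T⇒≡true {true} _ = ≡.refl

T-does⇒ : ∀ {A : Set} (d : Dec A) → T (does d) → A
T-does⇒ (yes a) _ = a

⇒T-does : ∀ {A : Set} (d : Dec A) → A → T (does d)
⇒T-does (yes _)  _ = tt
⇒T-does (no ¬a) a = ¬a a

module Counting where
  open ≡ using (refl)
  open import Data.Nat using (_+_; _*_; _^_)
  open MonoidSum ℕ.+-0-commutativeMonoid using (sum; ∑-distrib-+; sum-cong-≗; sum-replicate-zero)
  open import Data.Nat.ListAction using () renaming (sum to sumᴸ)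
  open ℕ.≤-Reasoning
  open import Algebra.Properties.CommutativeSemigroup ℕ.+-commutativeSemigroup using () renaming (interchange to +-interchange)

  indicator : Bool → ℕ
  indicator true  = 1
  indicator false = 0

  indicator≤1 : ∀ b → indicator b ≤ 1
  indicator≤1 true  = ℕ.≤-refl
  indicator≤1 false = z≤n

  count : ∀ {A : Set} → (A → Bool) → List A → ℕ
  count c []      = 0
  count c (a ∷ l) = indicator (c a) + count c l

  length-filter≡count : ∀ {A : Set} {P : A → Set} (P? : ∀ a → Dec (P a)) (l : List A) →
    length (filter P? l) ≡ count (does ∘ P?) l
  length-filter≡count P? []      = refl
  length-filter≡count P? (a ∷ l) with does (P? a)
  ... | true  = cong suc (length-filter≡count P? l)
  ... | false = length-filter≡count P? l

  count-++ : ∀ {A : Set} (c : A → Bool) (l l′ : List A) → count c (l ++ l′) ≡ count c l + count c l′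
  count-++ c []      l′ = refl
  count-++ c (a ∷ l) l′ = ≡.trans (cong (indicator (c a) +_) (count-++ c l l′)) (≡.sym (ℕ.+-assoc (indicator (c a)) _ _))

  count-map : ∀ {A B : Set} (c : B → Bool) (g : A → B) (l : List A) → count c (map g l) ≡ count (c ∘ g) l
  count-map c g []      = refl
  count-map c g (a ∷ l) = cong (indicator (c (g a)) +_) (count-map c g l)

  count-const-true : ∀ {A : Set} (l : List A) → count (λ _ → true) l ≡ length l
  count-const-true []      = refl
  count-const-true (a ∷ l) = cong suc (count-const-true l)

  sum-≤-* : ∀ {k} (f : Fin k → ℕ) {c} → (∀ i → f i ≤ c) → sum f ≤ k * c
  sum-≤-* {zero}  f h = z≤n
  sum-≤-* {suc k} f h = ℕ.+-mono-≤ (h zero) (sum-≤-* (f ∘ suc) (h ∘ suc))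

  sum-indicator-unique : ∀ {k} (g : Fin k → Bool) → (∀ a a′ → T (g a) → T (g a′) → a ≡ a′) →
    sum (indicator ∘ g) ≤ 1
  sum-indicator-unique {zero}  g h = z≤n
  sum-indicator-unique {suc k} g h with g zero in e
  ... | true  = ℕ.≤-reflexive (cong suc (≡.trans (sum-cong-≗ others-false) (sum-replicate-zero k)))
    where
    others-false : ∀ i → indicator (g (suc i)) ≡ 0
    others-false i with g (suc i) in e′
    ... | true with () ← h zero (suc i) (≡true⇒T e) (≡true⇒T e′)
    ... | false = refl
  ... | false = sum-indicator-unique (g ∘ suc) (λ a a′ p p′ → Fin.suc-injective (h (suc a) (suc a′) p p′))

  sum-count-≤-length : ∀ {A : Set} {k} (cs : Fin k → A → Bool) →
    (∀ w a a′ → T (cs a w) → T (cs a′ w) → a ≡ a′) → ∀ l → sum (λ a → count (cs a) l) ≤ length l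
  sum-count-≤-length {k = k} cs unique []      = ℕ.≤-reflexive (sum-replicate-zero k)
  sum-count-≤-length         cs unique (w ∷ l) = begin
    sum (λ a → indicator (cs a w) + count (cs a) l)        ≡⟨ ∑-distrib-+ (λ a → indicator (cs a w)) (λ a → count (cs a) l) ⟩
    sum (λ a → indicator (cs a w)) + sum (λ a → count (cs a) l)
      ≤⟨ ℕ.+-mono-≤ (sum-indicator-unique (λ a → cs a w) (unique w)) (sum-count-≤-length cs unique l) ⟩
    suc (length l)                                           ∎

  count-concatMap-tabulate : ∀ {A B : Set} (c : B → Bool) {k} (t : Fin k → A) (f : A → List B) →
    count c (concatMap f (List.tabulate t)) ≡ sum (λ a → count c (f (t a)))
  count-concatMap-tabulate c {zero}  t f = refl
  count-concatMap-tabulate c {suc k} t f =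
    ≡.trans (count-++ c (f (t zero)) _) (cong (count c (f (t zero)) +_) (count-concatMap-tabulate c (t ∘ suc) f))

  module _ {q : ℕ} where

    count-allFuns-suc : ∀ n (c : (Fin (suc n) → Fin q) → Bool) →
      count c (allFuns (suc n) q) ≡ sum (λ a → count (c ∘ consF a) (allFuns n q))
    count-allFuns-suc n c = ≡.trans (count-concatMap-tabulate c (λ a → a) (λ a → map (consF a) (allFuns n q)))
                                    (sum-cong-≗ (λ a → count-map c (consF a) (allFuns n q)))

    count-allFuns-≤ : ∀ n (c : (Fin n → Fin q) → Bool) → count c (allFuns n q) ≤ q ^ n
    count-allFuns-≤ zero    c = ℕ.+-mono-≤ (indicator≤1 _) z≤n
    count-allFuns-≤ (suc n) c = begin
      count c (allFuns (suc n) q)                   ≡⟨ count-allFuns-suc n c ⟩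
      sum (λ a → count (c ∘ consF a) (allFuns n q)) ≤⟨ sum-≤-* _ (λ a → count-allFuns-≤ n (c ∘ consF a)) ⟩
      q * q ^ n                                     ∎

    length-allFuns-≤ : ∀ n → length (allFuns n q) ≤ q ^ n
    length-allFuns-≤ n = ℕ.≤-trans (ℕ.≤-reflexive (≡.sym (count-const-true (allFuns n q)))) (count-allFuns-≤ n _)

    CoordinateDetermined : ∀ {n} → Fin n → ((Fin n → Fin q) → Bool) → Set
    CoordinateDetermined j c = ∀ v v′ → (∀ i → i ≢ j → v i ≡ v′ i) → T (c v) → T (c v′) → v j ≡ v′ j

    count-allFuns-≤-determined : ∀ n (j : Fin (suc n)) c → CoordinateDetermined j c →
      count c (allFuns (suc n) q) ≤ q ^ n
    count-allFuns-≤-determined n zero c det = begin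
      count c (allFuns (suc n) q)                   ≡⟨ count-allFuns-suc n c ⟩
      sum (λ a → count (c ∘ consF a) (allFuns n q))
        ≤⟨ sum-count-≤-length (λ a → c ∘ consF a) (λ w a a′ → det (consF a w) (consF a′ w) (agree-off-zero a a′ w)) (allFuns n q) ⟩
      length (allFuns n q)                          ≤⟨ length-allFuns-≤ n ⟩
      q ^ n                                         ∎
      where
      agree-off-zero : ∀ a a′ w i → i ≢ zero → consF a w i ≡ consF a′ w i
      agree-off-zero a a′ w zero    i≢0 = ⊥-elim (i≢0 refl)
      agree-off-zero a a′ w (suc i) _   = refl
    count-allFuns-≤-determined (suc n) (suc j) c det = begin
      count c (allFuns (suc (suc n)) q)                   ≡⟨ count-allFuns-suc (suc n) c ⟩
      sum (λ a → count (c ∘ consF a) (allFuns (suc n) q))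
        ≤⟨ sum-≤-* _ (λ a → count-allFuns-≤-determined n j (c ∘ consF a)
                              (λ v v′ agree → det (consF a v) (consF a v′) (agree-cons a v v′ agree))) ⟩
      q * q ^ n                                           ∎
      where
      agree-cons : ∀ a v v′ → (∀ i → i ≢ j → v i ≡ v′ i) → ∀ i → i ≢ suc j → consF a v i ≡ consF a v′ i
      agree-cons a v v′ agree zero    _    = refl
      agree-cons a v v′ agree (suc i) i≢sj = agree i (i≢sj ∘ cong suc)

  sumᴸ-map-+ : ∀ {A : Set} (f g : A → ℕ) (xs : List A) →
    sumᴸ (map (λ x → f x + g x) xs) ≡ sumᴸ (map f xs) + sumᴸ (map g xs)
  sumᴸ-map-+ f g []       = refl
  sumᴸ-map-+ f g (x ∷ xs) = ≡.trans (cong (f x + g x +_) (sumᴸ-map-+ f g xs))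
                                    (+-interchange (f x) (g x) _ _)

  sumᴸ-map-≤ : ∀ {A : Set} (f : A → ℕ) {c} → (∀ x → f x ≤ c) → ∀ xs → sumᴸ (map f xs) ≤ length xs * c
  sumᴸ-map-≤ f h []       = z≤n
  sumᴸ-map-≤ f h (x ∷ xs) = ℕ.+-mono-≤ (h x) (sumᴸ-map-≤ f h xs)

  1≤sumᴸ-indicator : ∀ {A : Set} (g : A → Bool) {xs} → Any (T ∘ g) xs → 1 ≤ sumᴸ (map (indicator ∘ g) xs)
  1≤sumᴸ-indicator g {x ∷ xs} (here gx) with g x
  ... | true = s≤s z≤n
  1≤sumᴸ-indicator g {x ∷ xs} (there p) = ℕ.≤-trans (1≤sumᴸ-indicator g p) (ℕ.m≤n+m _ (indicator (g x)))

  count-≤-sum-cover : ∀ {A I : Set} (s : A → Bool) (H : I → A → Bool) (is : List I) →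
    (∀ a → T (s a) → Any (λ i → T (H i a)) is) →
    ∀ l → count s l ≤ sumᴸ (map (λ i → count (H i) l) is)
  count-≤-sum-cover s H is cover []      = z≤n
  count-≤-sum-cover s H is cover (a ∷ l) = begin
    indicator (s a) + count s l
      ≤⟨ ℕ.+-mono-≤ head-bound (count-≤-sum-cover s H is cover l) ⟩
    sumᴸ (map (λ i → indicator (H i a)) is) + sumᴸ (map (λ i → count (H i) l) is)
      ≡⟨ ≡.sym (sumᴸ-map-+ (λ i → indicator (H i a)) (λ i → count (H i) l) is) ⟩
    sumᴸ (map (λ i → indicator (H i a) + count (H i) l) is) ∎
    where
    head-bound : indicator (s a) ≤ sumᴸ (map (λ i → indicator (H i a)) is)
    head-bound with s a in e
    ... | false = z≤n
    ... | true  = 1≤sumᴸ-indicator (λ i → H i a) (cover a (≡true⇒T e))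

module Evaluation (R : CommutativeRing 0ℓ 0ℓ) where
  open CommutativeRing R hiding (zero)
  open Polynomials R
  open import Relation.Binary.Reasoning.Setoid setoid
  open import Algebra.Properties.Ring ring using (-‿distribˡ-*; -0#≈0#; -‿+-comm)
  open import Algebra.Properties.CommutativeSemigroup +-commutativeSemigroup using () renaming (interchange to +-interchange)
  open import Algebra.Properties.CommutativeSemigroup *-commutativeSemigroup using () renaming (interchange to *-interchange)

  sumOver : ∀ {A : Set} → (A → Carrier) → List A → Carrier
  sumOver h l = Σᴸ (map h l)

  sumOver-cong : ∀ {A : Set} {h h′ : A → Carrier} (l : List A) → (∀ a → h a ≈ h′ a) → sumOver h l ≈ sumOver h′ l
  sumOver-cong []      p = refl
  sumOver-cong (a ∷ l) p = +-cong (p a) (sumOver-cong l p)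

  sumOver-++ : ∀ {A : Set} (h : A → Carrier) (l l′ : List A) → sumOver h (l ++ l′) ≈ sumOver h l + sumOver h l′
  sumOver-++ h []      l′ = sym (+-identityˡ _)
  sumOver-++ h (a ∷ l) l′ = trans (+-congˡ (sumOver-++ h l l′)) (sym (+-assoc _ _ _))

  sumOver-map : ∀ {A B : Set} (h : B → Carrier) (g : A → B) (l : List A) → sumOver h (map g l) ≡ sumOver (h ∘ g) l
  sumOver-map h g []      = ≡.refl
  sumOver-map h g (a ∷ l) = cong (h (g a) +_) (sumOver-map h g l)

  sumOver-concatMap : ∀ {A B : Set} (h : B → Carrier) (f : A → List B) (l : List A) →
    sumOver h (concatMap f l) ≈ sumOver (λ a → sumOver h (f a)) l
  sumOver-concatMap h f []      = refl
  sumOver-concatMap h f (a ∷ l) = trans (sumOver-++ h (f a) (concatMap f l)) (+-congˡ (sumOver-concatMap h f l))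

  sumOver-+ : ∀ {A : Set} (h h′ : A → Carrier) (l : List A) → sumOver (λ a → h a + h′ a) l ≈ sumOver h l + sumOver h′ l
  sumOver-+ h h′ []      = sym (+-identityˡ 0#)
  sumOver-+ h h′ (a ∷ l) = trans (+-congˡ (sumOver-+ h h′ l)) (+-interchange _ _ _ _)

  sumOver-*ˡ : ∀ {A : Set} (c : Carrier) (h : A → Carrier) (l : List A) → sumOver (λ a → c * h a) l ≈ c * sumOver h l
  sumOver-*ˡ c h []      = sym (zeroʳ c)
  sumOver-*ˡ c h (a ∷ l) = trans (+-congˡ (sumOver-*ˡ c h l)) (sym (distribˡ c _ _))

  sumOver-zero : ∀ {A : Set} (h : A → Carrier) (l : List A) → (∀ a → h a ≈ 0#) → sumOver h l ≈ 0#
  sumOver-zero h []      p = refl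
  sumOver-zero h (a ∷ l) p = trans (+-cong (p a) (sumOver-zero h l p)) (+-identityˡ 0#)

  sumOver-neg : ∀ {A : Set} (h : A → Carrier) (l : List A) → sumOver (λ a → - h a) l ≈ - sumOver h l
  sumOver-neg h []      = sym -0#≈0#
  sumOver-neg h (a ∷ l) = trans (+-congˡ (sumOver-neg h l)) (-‿+-comm _ _)

  sumTo : (ℕ → Carrier) → ℕ → Carrier
  sumTo ψ zero    = 0#
  sumTo ψ (suc N) = ψ 0 + sumTo (ψ ∘ suc) N

  sumTo-cong : ∀ {ψ ψ′ : ℕ → Carrier} N → (∀ a → ψ a ≈ ψ′ a) → sumTo ψ N ≈ sumTo ψ′ N
  sumTo-cong zero    p = refl
  sumTo-cong (suc N) p = +-cong (p 0) (sumTo-cong N (p ∘ suc))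

  sumTo-zero : ∀ (ψ : ℕ → Carrier) N → (∀ a → a < N → ψ a ≈ 0#) → sumTo ψ N ≈ 0#
  sumTo-zero ψ zero    p = refl
  sumTo-zero ψ (suc N) p = trans (+-cong (p 0 (s≤s z≤n)) (sumTo-zero (ψ ∘ suc) N (λ a a<N → p (suc a) (s≤s a<N)))) (+-identityˡ 0#)

  sumTo-sucʳ : ∀ (ψ : ℕ → Carrier) N → sumTo ψ (suc N) ≈ sumTo ψ N + ψ N
  sumTo-sucʳ ψ zero    = trans (+-identityʳ _) (sym (+-identityˡ _))
  sumTo-sucʳ ψ (suc N) = trans (+-congˡ (sumTo-sucʳ (ψ ∘ suc) N)) (sym (+-assoc _ _ _))

  sumTo-single : ∀ (ψ : ℕ → Carrier) N t → t < N → (∀ a → a ≢ t → ψ a ≈ 0#) → sumTo ψ N ≈ ψ t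
  sumTo-single ψ (suc N) zero    _         p =
    trans (+-congˡ (sumTo-zero (ψ ∘ suc) N (λ a _ → p (suc a) (λ ())))) (+-identityʳ _)
  sumTo-single ψ (suc N) (suc t) (s≤s t<N) p =
    trans (+-cong (p 0 (λ ())) (sumTo-single (ψ ∘ suc) N t t<N (λ a a≢t → p (suc a) (a≢t ∘ ℕ.suc-injective)))) (+-identityˡ _)

  sumOver-applyUpTo : ∀ (ψ : ℕ → Carrier) (f : ℕ → ℕ) N → sumOver ψ (applyUpTo f N) ≈ sumTo (ψ ∘ f) N
  sumOver-applyUpTo ψ f zero    = refl
  sumOver-applyUpTo ψ f (suc N) = +-congˡ (sumOver-applyUpTo ψ (f ∘ suc) N)

  sumOver-below-suc : ∀ n (e : Exp (suc n)) (h : Exp (suc n) → Carrier) →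
    sumOver h (below (suc n) e) ≈ sumTo (λ a → sumOver (h ∘ cons a) (below n (e ∘ suc))) (suc (e zero))
  sumOver-below-suc n e h = begin
    sumOver h (below (suc n) e)
      ≈⟨ sumOver-concatMap h (λ a → map (cons a) (below n (e ∘ suc))) (upTo (suc (e zero))) ⟩
    sumOver (λ a → sumOver h (map (cons a) (below n (e ∘ suc)))) (upTo (suc (e zero)))
      ≈⟨ sumOver-cong (upTo (suc (e zero))) (λ a → reflexive (sumOver-map h (cons a) (below n (e ∘ suc)))) ⟩
    sumOver (λ a → sumOver (h ∘ cons a) (below n (e ∘ suc))) (upTo (suc (e zero)))
      ≈⟨ sumOver-applyUpTo _ (λ a → a) (suc (e zero)) ⟩
    sumTo (λ a → sumOver (h ∘ cons a) (below n (e ∘ suc))) (suc (e zero)) ∎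

  sumBox : ∀ n → ℕ → (Exp n → Carrier) → Carrier
  sumBox n B h = sumOver h (below n (λ _ → B))

  sumBox-suc : ∀ n B (h : Exp (suc n) → Carrier) → sumBox (suc n) B h ≈ sumTo (λ a → sumBox n B (h ∘ cons a)) (suc B)
  sumBox-suc n B h = sumOver-below-suc n (λ _ → B) h

  Extensional : ∀ {n} → (Exp n → Carrier) → Set
  Extensional {n} g = ∀ {e e′ : Exp n} → e ≗ e′ → g e ≈ g e′

  below-cong : ∀ n {e e′ : Exp n} → e ≗ e′ → below n e ≡ below n e′
  below-cong zero    p = ≡.refl
  below-cong (suc n) p =
    cong₂ (λ l b → concatMap (λ a → map (cons a) l) (upTo (suc b))) (below-cong n (p ∘ suc)) (p zero)

  eqExp-sound : ∀ n (e t : Exp n) → T (eqExp n e t) → e ≗ t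
  eqExp-sound (suc n) e t h i with e zero ℕ.≟ t zero
  eqExp-sound (suc n) e t h zero    | yes p = p
  eqExp-sound (suc n) e t h (suc i) | yes p = eqExp-sound n (e ∘ suc) (t ∘ suc) h i

  eqExp-complete : ∀ n (e t : Exp n) → e ≗ t → T (eqExp n e t)
  eqExp-complete zero    e t p = tt
  eqExp-complete (suc n) e t p with e zero ℕ.≟ t zero
  ... | yes _   = eqExp-complete n (e ∘ suc) (t ∘ suc) (p ∘ suc)
  ... | no e≢t = e≢t (p zero)

  eqExp-cong : ∀ n {e e′ : Exp n} (t : Exp n) → e ≗ e′ → eqExp n e t ≡ eqExp n e′ t
  eqExp-cong n {e} {e′} t p =
    T-ext (λ h → eqExp-complete n e′ t (λ i → ≡.trans (≡.sym (p i)) (eqExp-sound n e t h i)))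
          (λ h → eqExp-complete n e t (λ i → ≡.trans (p i) (eqExp-sound n e′ t h i)))

  if-cong-cond : ∀ {b b′ : Bool} {x y : Carrier} → b ≡ b′ → (if b then x else y) ≈ (if b′ then x else y)
  if-cong-cond ≡.refl = refl

  1ₚ-ext : ∀ {n} → Extensional (1ₚ {n})
  1ₚ-ext {n} p = if-cong-cond (eqExp-cong n _ p)

  -ₚ-ext : ∀ {n} {f : Poly n} → Extensional f → Extensional (-ₚ f)
  -ₚ-ext ef p = -‿cong (ef p)

  *ₚ-ext : ∀ {n} (f g : Poly n) → Extensional g → Extensional (f *ₚ g)
  *ₚ-ext {n} f g eg {e} {e′} p =
    trans (sumOver-cong (below n e) (λ a → *-congˡ (eg (λ i → cong (ℕ._∸ a i) (p i)))))
          (reflexive (cong (sumOver (λ a → f a * g (λ i → e′ i ℕ.∸ a i))) (below-cong n p)))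

  ^ₚ-ext : ∀ {n} (f : Poly n) k → Extensional (f ^ₚ k)
  ^ₚ-ext f zero    = 1ₚ-ext
  ^ₚ-ext f (suc k) = *ₚ-ext f (f ^ₚ k) (^ₚ-ext f k)

  Σₚ-ext : ∀ {n} {A : Set} (G : A → Poly n) (l : List A) → (∀ a → Extensional (G a)) → Extensional (Σₚ (map G l))
  Σₚ-ext G []      h p = refl
  Σₚ-ext G (a ∷ l) h p = +-cong (h a p) (Σₚ-ext G l h p)

  leExp : ∀ n → Exp n → Exp n → Bool
  leExp zero    t e = true
  leExp (suc n) t e = (t zero ℕ.≤ᵇ e zero) ∧ leExp n (t ∘ suc) (e ∘ suc)

  δ : ∀ {n} → Exp n → Exp n → Carrier
  δ {n} t a = if eqExp n a t then 1# else 0#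

  cons-cong : ∀ {n} a {r r′ : Exp n} → r ≗ r′ → cons a r ≗ cons a r′
  cons-cong a p zero    = ≡.refl
  cons-cong a p (suc i) = p i

  cons-η : ∀ {n} (t : Exp (suc n)) → cons (t zero) (t ∘ suc) ≗ t
  cons-η t zero    = ≡.refl
  cons-η t (suc i) = ≡.refl

  eqExp-cons-head : ∀ n (t : Exp (suc n)) r → eqExp (suc n) (cons (t zero) r) t ≡ eqExp n r (t ∘ suc)
  eqExp-cons-head n t r =
    T-ext (λ h → eqExp-complete n r (t ∘ suc) (λ i → eqExp-sound (suc n) (cons (t zero) r) t h (suc i)))
          (λ h → eqExp-complete (suc n) (cons (t zero) r) t λ { zero → ≡.refl ; (suc i) → eqExp-sound n r (t ∘ suc) h i })

  eqExp-cons-other : ∀ n (t : Exp (suc n)) a r → a ≢ t zero → eqExp (suc n) (cons a r) t ≡ false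
  eqExp-cons-other n t a r a≢t = T-ext (λ h → a≢t (eqExp-sound (suc n) (cons a r) t h zero)) λ ()

  sumOver-below-δ : ∀ n (t e : Exp n) (φ : Exp n → Carrier) → Extensional φ →
    sumOver (λ a → δ t a * φ a) (below n e) ≈ (if leExp n t e then φ t else 0#)
  sumOver-below-δ zero    t e φ eφ = trans (+-identityʳ _) (trans (*-identityˡ _) (eφ λ ()))
  sumOver-below-δ (suc n) t e φ eφ = trans (sumOver-below-suc n e _) sum-over-head
    where
    slice : ℕ → Carrier
    slice a = sumOver (λ r → δ t (cons a r) * φ (cons a r)) (below n (e ∘ suc))
    slice-head : slice (t zero) ≈ (if leExp n (t ∘ suc) (e ∘ suc) then φ t else 0#)
    slice-head = begin
      slice (t zero)
        ≈⟨ sumOver-cong (below n (e ∘ suc)) (λ r → *-congʳ (if-cong-cond (eqExp-cons-head n t r))) ⟩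
      sumOver (λ r → δ (t ∘ suc) r * φ (cons (t zero) r)) (below n (e ∘ suc))
        ≈⟨ sumOver-below-δ n (t ∘ suc) (e ∘ suc) (φ ∘ cons (t zero)) (eφ ∘ cons-cong (t zero)) ⟩
      (if leExp n (t ∘ suc) (e ∘ suc) then φ (cons (t zero) (t ∘ suc)) else 0#)
        ≈⟨ η-branch (leExp n (t ∘ suc) (e ∘ suc)) ⟩
      (if leExp n (t ∘ suc) (e ∘ suc) then φ t else 0#) ∎
      where
      η-branch : ∀ b → (if b then φ (cons (t zero) (t ∘ suc)) else 0#) ≈ (if b then φ t else 0#)
      η-branch true  = eφ (cons-η t)
      η-branch false = refl
    slice-other : ∀ a → a ≢ t zero → slice a ≈ 0#
    slice-other a a≢t = sumOver-zero _ (below n (e ∘ suc))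
      (λ r → trans (*-congʳ (if-cong-cond (eqExp-cons-other n t a r a≢t))) (zeroˡ _))
    sum-over-head : sumTo slice (suc (e zero)) ≈ (if leExp (suc n) t e then φ t else 0#)
    sum-over-head with t zero ℕ.≤ᵇ e zero in t≤e
    ... | true  = trans (sumTo-single slice (suc (e zero)) (t zero)
                           (s≤s (ℕ.≤ᵇ⇒≤ (t zero) (e zero) (≡true⇒T t≤e))) slice-other) slice-head
    ... | false = sumTo-zero slice (suc (e zero)) (λ a a≤e → slice-other a (λ { ≡.refl → t≰e a≤e }))
      where
      t≰e : t zero < suc (e zero) → ⊥
      t≰e (s≤s t≤e′) with () ← ≡.trans (≡.sym (T⇒≡true (ℕ.≤⇒≤ᵇ t≤e′))) t≤e

  ExponentsBelow : ∀ {n} → ℕ → (Exp n → Carrier) → Set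
  ExponentsBelow {n} B g = ∀ (e : Exp n) i → B ≤ e i → g e ≈ 0#

  sumTo-shift : ∀ B d (φ : ℕ → Carrier) → (∀ b → B < b → φ b ≈ 0#) →
    sumTo (λ a → φ (a ℕ.+ d)) (suc B) ≈ sumTo (λ a → if d ℕ.≤ᵇ a then φ a else 0#) (suc B)
  sumTo-shift B zero    φ φ-vanishes = sumTo-cong (suc B) (λ a → reflexive (cong φ (ℕ.+-identityʳ a)))
  sumTo-shift B (suc d) φ φ-vanishes = begin
    sumTo (λ a → φ (a ℕ.+ suc d)) (suc B)  ≈⟨ sumTo-cong (suc B) (λ a → reflexive (cong φ (ℕ.+-suc a d))) ⟩
    sumTo (λ a → φ (suc (a ℕ.+ d))) (suc B) ≈⟨ sumTo-shift B d (φ ∘ suc) (λ b B<b → φ-vanishes (suc b) (ℕ.m<n⇒m<1+n B<b)) ⟩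
    sumTo χ (suc B)                         ≈⟨ sumTo-sucʳ χ B ⟩
    sumTo χ B + χ B                         ≈⟨ +-congˡ χ-last ⟩
    sumTo χ B + 0#                          ≈⟨ trans (+-identityʳ _) (sym (+-identityˡ _)) ⟩
    0# + sumTo χ B                          ≈⟨ +-congˡ (sumTo-cong B (λ a → if-cong-cond (≡.sym (<ᵇ-suc d a)))) ⟩
    sumTo (λ a → if suc d ℕ.≤ᵇ a then φ a else 0#) (suc B) ∎
    where
    χ : ℕ → Carrier
    χ a = if d ℕ.≤ᵇ a then φ (suc a) else 0#
    χ-last : χ B ≈ 0#
    χ-last with d ℕ.≤ᵇ B
    ... | true  = φ-vanishes (suc B) (ℕ.n<1+n B)
    ... | false = refl
    <ᵇ-suc : ∀ d a → (d ℕ.<ᵇ suc a) ≡ (d ℕ.≤ᵇ a)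
    <ᵇ-suc zero    a = ≡.refl
    <ᵇ-suc (suc d) a = ≡.refl

  sumBox-shift : ∀ n B (d : Exp n) (h : Exp n → Carrier) → Extensional h → ExponentsBelow (suc B) h →
    sumBox n B (λ e → h (λ i → e i ℕ.+ d i)) ≈ sumBox n B (λ f → if leExp n d f then h f else 0#)
  sumBox-shift zero    B d h eh h-below = +-congʳ (eh λ ())
  sumBox-shift (suc n) B d h eh h-below = begin
    sumBox (suc n) B (λ e → h (λ i → e i ℕ.+ d i))
      ≈⟨ sumBox-suc n B _ ⟩
    sumTo (λ a → sumBox n B (λ r → h (λ i → cons a r i ℕ.+ d i))) (suc B)
      ≈⟨ sumTo-cong (suc B) (λ a → sumOver-cong (below n (λ _ → B)) (λ r → eh (shift-cons a r))) ⟩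
    sumTo (λ a → sumBox n B (λ r → h (cons (a ℕ.+ d zero) (λ i → r i ℕ.+ d (suc i))))) (suc B)
      ≈⟨ sumTo-cong (suc B) (λ a → sumBox-shift n B (d ∘ suc) (h ∘ cons (a ℕ.+ d zero)) (eh ∘ cons-cong _)
                                     (λ f i → h-below (cons (a ℕ.+ d zero) f) (suc i))) ⟩
    sumTo (λ a → Φ (a ℕ.+ d zero)) (suc B)
      ≈⟨ sumTo-shift B (d zero) Φ Φ-vanishes ⟩
    sumTo (λ a → if d zero ℕ.≤ᵇ a then Φ a else 0#) (suc B)
      ≈⟨ sumTo-cong (suc B) merge-conditions ⟩
    sumTo (λ a → sumBox n B (λ r → if leExp (suc n) d (cons a r) then h (cons a r) else 0#)) (suc B)
      ≈⟨ sumBox-suc n B _ ⟨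
    sumBox (suc n) B (λ f → if leExp (suc n) d f then h f else 0#) ∎
    where
    shift-cons : ∀ a r → (λ i → cons a r i ℕ.+ d i) ≗ cons (a ℕ.+ d zero) (λ i → r i ℕ.+ d (suc i))
    shift-cons a r zero    = ≡.refl
    shift-cons a r (suc i) = ≡.refl
    Φ : ℕ → Carrier
    Φ b = sumBox n B (λ r → if leExp n (d ∘ suc) r then h (cons b r) else 0#)
    Φ-vanishes : ∀ b → B < b → Φ b ≈ 0#
    Φ-vanishes b B<b = sumOver-zero _ (below n (λ _ → B)) (λ r → vanish r (leExp n (d ∘ suc) r))
      where
      vanish : ∀ r c → (if c then h (cons b r) else 0#) ≈ 0#
      vanish r true  = h-below (cons b r) zero B<b
      vanish r false = refl
    merge-conditions : ∀ a → (if d zero ℕ.≤ᵇ a then Φ a else 0#)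
      ≈ sumBox n B (λ r → if (d zero ℕ.≤ᵇ a) ∧ leExp n (d ∘ suc) r then h (cons a r) else 0#)
    merge-conditions a with d zero ℕ.≤ᵇ a
    ... | true  = refl
    ... | false = sym (sumOver-zero _ (below n (λ _ → B)) (λ r → refl))

  unitExp-same : ∀ {n} (j : Fin n) → unitExp j j ≡ 1
  unitExp-same j with toℕ j ℕ.≟ toℕ j
  ... | yes _   = ≡.refl
  ... | no j≢j = ⊥-elim (j≢j ≡.refl)

  unitExp-other : ∀ {n} (j i : Fin n) → j ≢ i → unitExp j i ≡ 0
  unitExp-other j i j≢i with toℕ j ℕ.≟ toℕ i
  ... | yes j≡i = ⊥-elim (j≢i (Fin.toℕ-injective j≡i))
  ... | no _    = ≡.refl

  unitExp-suc : ∀ {n} (j i : Fin n) → unitExp (suc j) (suc i) ≡ unitExp j i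
  unitExp-suc j i with j Fin.≟ i
  ... | yes ≡.refl = ≡.trans (unitExp-same (suc j)) (≡.sym (unitExp-same j))
  ... | no j≢i     = ≡.trans (unitExp-other (suc j) (suc i) (j≢i ∘ Fin.suc-injective)) (≡.sym (unitExp-other j i j≢i))

  unitExp≤1 : ∀ {n} (j i : Fin n) → unitExp j i ≤ 1
  unitExp≤1 j i with j Fin.≟ i
  ... | yes ≡.refl = ℕ.≤-reflexive (unitExp-same j)
  ... | no j≢i     = ℕ.≤-trans (ℕ.≤-reflexive (unitExp-other j i j≢i)) z≤n

  leExp-cong : ∀ n {t t′ : Exp n} (e : Exp n) → t ≗ t′ → leExp n t e ≡ leExp n t′ e
  leExp-cong zero    e p = ≡.refl
  leExp-cong (suc n) e p = cong₂ _∧_ (cong (ℕ._≤ᵇ e zero) (p zero)) (leExp-cong n (e ∘ suc) (p ∘ suc))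

  leExp-zero : ∀ n (e : Exp n) → leExp n (λ _ → 0) e ≡ true
  leExp-zero zero    e = ≡.refl
  leExp-zero (suc n) e = leExp-zero n (e ∘ suc)

  ^ᴿ-cong : ∀ {x y : Carrier} k → x ≈ y → x ^ᴿ k ≈ y ^ᴿ k
  ^ᴿ-cong zero    p = refl
  ^ᴿ-cong (suc k) p = *-cong p (^ᴿ-cong k p)

  ^ᴿ-+ : ∀ x a b → x ^ᴿ (a ℕ.+ b) ≈ x ^ᴿ a * x ^ᴿ b
  ^ᴿ-+ x zero    b = sym (*-identityˡ _)
  ^ᴿ-+ x (suc a) b = trans (*-congˡ (^ᴿ-+ x a b)) (sym (*-assoc _ _ _))

  mono-ext : ∀ {n} (y : Fin n → Carrier) → Extensional (mono y)
  mono-ext {zero}  y p = refl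
  mono-ext {suc n} y p = *-cong (reflexive (cong (y zero ^ᴿ_) (p zero))) (mono-ext (y ∘ suc) (p ∘ suc))

  mono-+ : ∀ {n} (y : Fin n → Carrier) (e d : Exp n) → mono y (λ i → e i ℕ.+ d i) ≈ mono y e * mono y d
  mono-+ {zero}  y e d = sym (*-identityˡ 1#)
  mono-+ {suc n} y e d =
    trans (*-cong (^ᴿ-+ (y zero) (e zero) (d zero)) (mono-+ (y ∘ suc) (e ∘ suc) (d ∘ suc))) (*-interchange _ _ _ _)

  mono-zero : ∀ {n} (y : Fin n → Carrier) → mono y (λ _ → 0) ≈ 1#
  mono-zero {zero}  y = refl
  mono-zero {suc n} y = trans (*-identityˡ _) (mono-zero (y ∘ suc))

  mono-unitExp : ∀ {n} (y : Fin n → Carrier) (j : Fin n) → mono y (unitExp j) ≈ y j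
  mono-unitExp {suc n} y zero =
    trans (*-cong (trans (reflexive (cong (y zero ^ᴿ_) (unitExp-same {suc n} zero))) (*-identityʳ _))
                  (trans (mono-ext (y ∘ suc) (λ i → unitExp-other zero (suc i) λ ())) (mono-zero (y ∘ suc))))
          (*-identityʳ _)
  mono-unitExp {suc n} y (suc j) =
    trans (*-cong (reflexive (cong (y zero ^ᴿ_) (unitExp-other (suc j) zero λ ())))
                  (trans (mono-ext (y ∘ suc) (unitExp-suc j)) (mono-unitExp (y ∘ suc) j)))
          (*-identityˡ _)

  if-then-0-*ʳ : ∀ (b : Bool) (x z : Carrier) → (if b then x else 0#) * z ≈ (if b then x * z else 0#)
  if-then-0-*ʳ true  x z = refl
  if-then-0-*ʳ false x z = zeroˡ z

  X*-coeff : ∀ {n} (j : Fin n) (g : Poly n) → Extensional g → ∀ e →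
    (X j *ₚ g) e ≈ (if leExp n (unitExp j) e then g (λ i → e i ℕ.∸ unitExp j i) else 0#)
  X*-coeff {n} j g eg e =
    sumOver-below-δ n (unitExp j) e (λ a → g (λ i → e i ℕ.∸ a i)) (λ p → eg (λ i → cong (e i ℕ.∸_) (p i)))

  ∸-unitExp-≥ : ∀ {n B} (j : Fin n) (e : Exp n) i → suc B ≤ e i → B ≤ e i ℕ.∸ unitExp j i
  ∸-unitExp-≥ j e i B<e = ℕ.≤-trans (ℕ.∸-monoˡ-≤ 1 B<e) (ℕ.∸-monoʳ-≤ (e i) (unitExp≤1 j i))

  evalB-X* : ∀ {n} B (j : Fin n) (g : Poly n) → Extensional g → ExponentsBelow B g → ∀ y →
    evalB B (X j *ₚ g) y ≈ y j * evalB B g y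
  evalB-X* {n} B j g eg g-below y = begin
    evalB B (X j *ₚ g) y
      ≈⟨ sumOver-cong box (λ f → trans (*-congʳ (X*-coeff j g eg f)) (if-then-0-*ʳ _ _ _)) ⟩
    sumBox n B (λ f → if leExp n u f then H f else 0#)
      ≈⟨ sumBox-shift n B u H H-ext H-below ⟨
    sumBox n B (λ e → H (λ i → e i ℕ.+ u i))
      ≈⟨ sumOver-cong box H-shift ⟩
    sumBox n B (λ e → y j * (g e * mono y e))
      ≈⟨ sumOver-*ˡ (y j) _ box ⟩
    y j * evalB B g y ∎
    where
    box = below n (λ _ → B)
    u = unitExp j
    H : Exp n → Carrier
    H f = g (λ i → f i ℕ.∸ u i) * mono y f
    H-ext : Extensional H
    H-ext p = *-cong (eg (λ i → cong (ℕ._∸ u i) (p i))) (mono-ext y p)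
    H-below : ExponentsBelow (suc B) H
    H-below f i B<f = trans (*-congʳ (g-below _ i (∸-unitExp-≥ j f i B<f))) (zeroˡ _)
    H-shift : ∀ e → H (λ i → e i ℕ.+ u i) ≈ y j * (g e * mono y e)
    H-shift e = begin
      g (λ i → (e i ℕ.+ u i) ℕ.∸ u i) * mono y (λ i → e i ℕ.+ u i)
        ≈⟨ *-cong (eg (λ i → ℕ.m+n∸n≡m (e i) (u i))) (mono-+ y e u) ⟩
      g e * (mono y e * mono y u) ≈⟨ *-congˡ (*-congˡ (mono-unitExp y j)) ⟩
      g e * (mono y e * y j)      ≈⟨ trans (sym (*-assoc _ _ _)) (*-comm _ _) ⟩
      y j * (g e * mono y e)      ∎

  evalB-cong : ∀ {n} B {f f′ : Poly n} y → (∀ e → f e ≈ f′ e) → evalB B f y ≈ evalB B f′ y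
  evalB-cong {n} B y p = sumOver-cong (below n (λ _ → B)) (λ e → *-congʳ (p e))

  evalB-+ₚ : ∀ {n} B (f g : Poly n) y → evalB B (f +ₚ g) y ≈ evalB B f y + evalB B g y
  evalB-+ₚ {n} B f g y = trans (sumOver-cong (below n (λ _ → B)) (λ e → distribʳ _ _ _)) (sumOver-+ _ _ (below n (λ _ → B)))

  evalB-0ₚ : ∀ {n} B y → evalB B (0ₚ {n}) y ≈ 0#
  evalB-0ₚ {n} B y = sumOver-zero _ (below n (λ _ → B)) (λ e → zeroˡ _)

  evalB-neg : ∀ {n} B (f : Poly n) y → evalB B (-ₚ f) y ≈ - evalB B f y
  evalB-neg {n} B f y = trans (sumOver-cong (below n (λ _ → B)) (λ e → sym (-‿distribˡ-* _ _))) (sumOver-neg _ (below n (λ _ → B)))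

  evalB-Σₚ : ∀ {n} {A : Set} B (G : A → Poly n) (l : List A) y → evalB B (Σₚ (map G l)) y ≈ sumOver (λ a → evalB B (G a) y) l
  evalB-Σₚ B G []      y = evalB-0ₚ B y
  evalB-Σₚ B G (a ∷ l) y = trans (evalB-+ₚ B (G a) _ y) (+-congˡ (evalB-Σₚ B G l y))

  evalB-1ₚ : ∀ {n} B y → evalB B (1ₚ {n}) y ≈ 1#
  evalB-1ₚ {n} B y = trans (sumOver-below-δ n (λ _ → 0) (λ _ → B) (mono y) (mono-ext y))
                           (trans (if-cong-cond (leExp-zero n (λ _ → B))) (mono-zero y))

  *ₚ-distribʳ : ∀ {n} (f f′ g : Poly n) e → ((f +ₚ f′) *ₚ g) e ≈ (f *ₚ g) e + (f′ *ₚ g) e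
  *ₚ-distribʳ {n} f f′ g e = trans (sumOver-cong (below n e) (λ a → distribʳ _ _ _)) (sumOver-+ _ _ (below n e))

  *ₚ-zeroˡ : ∀ {n} (g : Poly n) e → (0ₚ *ₚ g) e ≈ 0#
  *ₚ-zeroˡ {n} g e = sumOver-zero _ (below n e) (λ a → zeroˡ _)

  ExponentsBelow-mono : ∀ {n} {B B′} {g : Poly n} → B ≤ B′ → ExponentsBelow B g → ExponentsBelow B′ g
  ExponentsBelow-mono B≤B′ g-below e i B′≤e = g-below e i (ℕ.≤-trans B≤B′ B′≤e)

  1ₚ-exponentsBelow : ∀ {n} → ExponentsBelow 1 (1ₚ {n})
  1ₚ-exponentsBelow {n} e i 1≤e with eqExp n e (λ _ → 0) in e≡0
  ... | true with () ← ℕ.≤-trans 1≤e (ℕ.≤-reflexive (eqExp-sound n e (λ _ → 0) (≡true⇒T e≡0) i))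
  ... | false = refl

  X*-exponentsBelow : ∀ {n} B (j : Fin n) (g : Poly n) → Extensional g → ExponentsBelow B g →
    ExponentsBelow (suc B) (X j *ₚ g)
  X*-exponentsBelow {n} B j g eg g-below e i B<e = trans (X*-coeff j g eg e) vanish
    where
    vanish : (if leExp n (unitExp j) e then g (λ i → e i ℕ.∸ unitExp j i) else 0#) ≈ 0#
    vanish with leExp n (unitExp j) e
    ... | true  = g-below _ i (∸-unitExp-≥ j e i B<e)
    ... | false = refl

  zeroAt : ∀ {n} → Fin n → (Fin n → Carrier) → Fin n → Carrier
  zeroAt zero    y zero    = 0#
  zeroAt zero    y (suc j) = y (suc j)
  zeroAt (suc J) y zero    = y zero
  zeroAt (suc J) y (suc j) = zeroAt J (y ∘ suc) j

  mono-zeroAt : ∀ {n} (J : Fin n) (y : Fin n → Carrier) (f : Exp n) →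
    mono (zeroAt J y) f ≈ (if 1 ℕ.≤ᵇ f J then 0# else mono y f)
  mono-zeroAt zero y f with f zero
  ... | zero  = refl
  ... | suc k = trans (*-congʳ (zeroˡ _)) (zeroˡ _)
  mono-zeroAt (suc J) y f = trans (*-congˡ (mono-zeroAt J (y ∘ suc) (f ∘ suc))) (pull-head (1 ℕ.≤ᵇ f (suc J)))
    where
    pull-head : ∀ b → (y zero ^ᴿ f zero) * (if b then 0# else mono (y ∘ suc) (f ∘ suc)) ≈ (if b then 0# else mono y f)
    pull-head true  = zeroʳ _
    pull-head false = refl

  leExp-raise : ∀ n (d d′ : Exp n) (J : Fin n) (f : Exp n) → d J ≡ 0 → d′ J ≡ 1 → (∀ i → i ≢ J → d i ≡ d′ i) →
    leExp n d′ f ≡ leExp n d f ∧ (1 ℕ.≤ᵇ f J)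
  leExp-raise (suc n) d d′ zero f dJ≡0 d′J≡1 others =
    ≡.trans (cong₂ _∧_ (cong (ℕ._≤ᵇ f zero) d′J≡1) (leExp-cong n (f ∘ suc) (λ i → ≡.sym (others (suc i) λ ()))))
    (≡.trans (Bool.∧-comm (1 ℕ.≤ᵇ f zero) _)
             (cong (λ z → ((z ℕ.≤ᵇ f zero) ∧ leExp n (d ∘ suc) (f ∘ suc)) ∧ (1 ℕ.≤ᵇ f zero)) (≡.sym dJ≡0)))
  leExp-raise (suc n) d d′ (suc J) f dJ≡0 d′J≡1 others =
    ≡.trans (cong₂ _∧_ (cong (ℕ._≤ᵇ f zero) (≡.sym (others zero λ ())))
                       (leExp-raise n (d ∘ suc) (d′ ∘ suc) J (f ∘ suc) dJ≡0 d′J≡1 (λ i i≢J → others (suc i) (i≢J ∘ Fin.suc-injective))))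
            (≡.sym (Bool.∧-assoc (d zero ℕ.≤ᵇ f zero) (leExp n (d ∘ suc) (f ∘ suc)) (1 ℕ.≤ᵇ f (suc J))))

  evalAbove : ∀ {n} → ℕ → Poly n → Exp n → (Fin n → Carrier) → Carrier
  evalAbove {n} B f d y = sumBox n B (λ e → if leExp n d e then f e * mono y e else 0#)

  evalAbove-zero : ∀ {n} B (f : Poly n) y → evalAbove B f (λ _ → 0) y ≈ evalB B f y
  evalAbove-zero {n} B f y = sumOver-cong (below n (λ _ → B)) (λ e → if-cong-cond (leExp-zero n e))

  if-∧-split : ∀ (b c : Bool) (a z z′ : Carrier) → z′ ≈ (if c then 0# else z) →
    (if b ∧ c then a * z else 0#) ≈ (if b then a * z else 0#) - (if b then a * z′ else 0#)
  if-∧-split false c     a z z′ p = sym (trans (+-congˡ -0#≈0#) (+-identityʳ 0#))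
  if-∧-split true  true  a z z′ p = sym (trans (+-congˡ (trans (-‿cong (trans (*-congˡ p) (zeroʳ a))) -0#≈0#)) (+-identityʳ _))
  if-∧-split true  false a z z′ p = sym (trans (+-congˡ (-‿cong (*-congˡ p))) (-‿inverseʳ _))

  evalAbove-raise : ∀ {n} B (f : Poly n) (d d′ : Exp n) (J : Fin n) → d J ≡ 0 → d′ J ≡ 1 → (∀ i → i ≢ J → d i ≡ d′ i) →
    ∀ y → evalAbove B f d′ y ≈ evalAbove B f d y - evalAbove B f d (zeroAt J y)
  evalAbove-raise {n} B f d d′ J dJ≡0 d′J≡1 others y = begin
    evalAbove B f d′ y
      ≈⟨ sumOver-cong box (λ e → trans (if-cong-cond (leExp-raise n d d′ J e dJ≡0 d′J≡1 others))
                                      (if-∧-split (leExp n d e) _ (f e) (mono y e) _ (mono-zeroAt J y e))) ⟩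
    sumBox n B (λ e → (if leExp n d e then f e * mono y e else 0#) - (if leExp n d e then f e * mono (zeroAt J y) e else 0#))
      ≈⟨ sumOver-+ _ _ box ⟩
    evalAbove B f d y + sumBox n B (λ e → - (if leExp n d e then f e * mono (zeroAt J y) e else 0#))
      ≈⟨ +-congˡ (sumOver-neg _ box) ⟩
    evalAbove B f d y - evalAbove B f d (zeroAt J y) ∎
    where
    box = below n (λ _ → B)

  evalAbove-shift : ∀ {n} B (f : Poly n) → Extensional f → ExponentsBelow (suc B) f → ∀ (d : Exp n) y →
    evalAbove B f d y ≈ evalB B (λ e → f (λ i → e i ℕ.+ d i)) y * mono y d
  evalAbove-shift {n} B f ef f-below d y = begin
    evalAbove B f d y
      ≈⟨ sumBox-shift n B d h h-ext h-below ⟨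
    sumBox n B (λ e → h (λ i → e i ℕ.+ d i))
      ≈⟨ sumOver-cong box (λ e → trans (*-congˡ (mono-+ y e d)) (sym (*-assoc _ _ _))) ⟩
    sumBox n B (λ e → (f (λ i → e i ℕ.+ d i) * mono y e) * mono y d)
      ≈⟨ sumOver-cong box (λ e → *-comm _ _) ⟩
    sumBox n B (λ e → mono y d * (f (λ i → e i ℕ.+ d i) * mono y e))
      ≈⟨ sumOver-*ˡ _ _ box ⟩
    mono y d * evalB B (λ e → f (λ i → e i ℕ.+ d i)) y
      ≈⟨ *-comm _ _ ⟩
    evalB B (λ e → f (λ i → e i ℕ.+ d i)) y * mono y d ∎
    where
    box = below n (λ _ → B)
    h : Exp n → Carrier
    h e = f e * mono y e
    h-ext : Extensional h
    h-ext p = *-cong (ef p) (mono-ext y p)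
    h-below : ExponentsBelow (suc B) h
    h-below e i B<e = trans (*-congʳ (f-below e i B<e)) (zeroˡ _)

  -- shiftExp m e is definitionally e + firstOnes m, so P is the numerator shifted by firstOnes.
  firstOnes : ∀ {n} → ℕ → Exp n
  firstOnes k j = if toℕ j ℕ.<ᵇ k then 1 else 0

  module _ {n} (B : ℕ) (f : Poly n) (Good : (Fin n → Carrier) → Set) {K : ℕ} (K≤n : K ≤ n)
           (zeroAt-Good : ∀ j y → toℕ j < K → Good y → Good (zeroAt j y))
           (eval-Good : ∀ y → Good y → evalB B f y ≈ 0#) where

    evalAbove-firstOnes : ∀ k → k ≤ K → ∀ y → Good y → evalAbove B f (firstOnes k) y ≈ 0#
    evalAbove-firstOnes zero    _     y good = trans (evalAbove-zero B f y) (eval-Good y good)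
    evalAbove-firstOnes (suc k) k<K y good = begin
      evalAbove B f (firstOnes (suc k)) y
        ≈⟨ evalAbove-raise B f (firstOnes k) (firstOnes (suc k)) J firstOnes-J firstOnes-suc-J firstOnes-other y ⟩
      evalAbove B f (firstOnes k) y - evalAbove B f (firstOnes k) (zeroAt J y)
        ≈⟨ +-cong (evalAbove-firstOnes k k≤K y good)
                  (-‿cong (evalAbove-firstOnes k k≤K (zeroAt J y) (zeroAt-Good J y (≡.subst (_< K) (≡.sym toℕJ) k<K) good))) ⟩
      0# - 0#
        ≈⟨ -‿inverseʳ 0# ⟩
      0# ∎
      where
      k≤K = ℕ.<⇒≤ k<K
      J : Fin n
      J = Fin.fromℕ< (ℕ.<-≤-trans k<K K≤n)
      toℕJ : toℕ J ≡ k
      toℕJ = Fin.toℕ-fromℕ< _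
      bit-cong : ∀ {b b′} → b ≡ b′ → (if b then 1 else 0) ≡ (if b′ then 1 else 0)
      bit-cong = cong (λ b → if b then 1 else 0)
      firstOnes-J : firstOnes k J ≡ 0
      firstOnes-J = bit-cong (≡.trans (cong (ℕ._<ᵇ k) toℕJ) (T-ext (λ t → ⊥-elim (ℕ.n≮n k (ℕ.<ᵇ⇒< k k t))) λ ()))
      firstOnes-suc-J : firstOnes (suc k) J ≡ 1
      firstOnes-suc-J = bit-cong (≡.trans (cong (ℕ._<ᵇ suc k) toℕJ) (T⇒≡true (ℕ.<⇒<ᵇ (ℕ.n<1+n k))))
      firstOnes-other : ∀ j → j ≢ J → firstOnes k j ≡ firstOnes (suc k) j
      firstOnes-other j j≢J = bit-cong (T-ext
        (λ t → ℕ.<⇒<ᵇ (ℕ.m<n⇒m<1+n (ℕ.<ᵇ⇒< _ k t)))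
        (λ t → ℕ.<⇒<ᵇ (ℕ.≤∧≢⇒< (ℕ.≤-pred (ℕ.<ᵇ⇒< _ (suc k) t)) (λ j≡k → j≢J (Fin.toℕ-injective (≡.trans j≡k (≡.sym toℕJ)))))))

  +ₚ-exponentsBelow : ∀ {n} B {f g : Poly n} → ExponentsBelow B f → ExponentsBelow B g → ExponentsBelow B (f +ₚ g)
  +ₚ-exponentsBelow B f-below g-below e i B≤e = trans (+-cong (f-below e i B≤e) (g-below e i B≤e)) (+-identityˡ 0#)

  sumSel*-exponentsBelow : ∀ {n k} B (I : Vec Bool k) (fs : Fin k → Poly n) (g : Poly n) →
    (∀ i → ExponentsBelow B (fs i *ₚ g)) → ExponentsBelow B (sumSel I fs *ₚ g)
  sumSel*-exponentsBelow B []          fs g h e i B≤e = *ₚ-zeroˡ g e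
  sumSel*-exponentsBelow B (true ∷ I)  fs g h e i B≤e =
    trans (*ₚ-distribʳ (fs zero) _ g e)
          (+ₚ-exponentsBelow B (h zero) (sumSel*-exponentsBelow B I (fs ∘ suc) g (h ∘ suc)) e i B≤e)
  sumSel*-exponentsBelow B (false ∷ I) fs g h = sumSel*-exponentsBelow B I (fs ∘ suc) g (h ∘ suc)

  Σₚ-exponentsBelow : ∀ {n} {A : Set} B (G : A → Poly n) (l : List A) → (∀ a → ExponentsBelow B (G a)) →
    ExponentsBelow B (Σₚ (map G l))
  Σₚ-exponentsBelow B G []      h e i B≤e = refl
  Σₚ-exponentsBelow B G (a ∷ l) h       = +ₚ-exponentsBelow B (h a) (Σₚ-exponentsBelow B G l h)

  signed-ext : ∀ {k n} (I : Vec Bool k) {f : Poly n} → Extensional f → Extensional (signed I f)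
  signed-ext I ef with even (card I)
  ... | true  = -ₚ-ext ef
  ... | false = ef

  signed-exponentsBelow : ∀ {k n} B (I : Vec Bool k) {f : Poly n} → ExponentsBelow B f → ExponentsBelow B (signed I f)
  signed-exponentsBelow B I f-below with even (card I)
  ... | true  = λ e i B≤e → trans (-‿cong (f-below e i B≤e)) -0#≈0#
  ... | false = f-below

  sign : ∀ {k} → Vec Bool k → Carrier → Carrier
  sign I c = if even (card I) then - c else c

  sign-cong : ∀ {k} (I : Vec Bool k) {c c′} → c ≈ c′ → sign I c ≈ sign I c′
  sign-cong I c≈c′ with even (card I)
  ... | true  = -‿cong c≈c′
  ... | false = c≈c′

  evalB-signed : ∀ {k n} B (I : Vec Bool k) (f : Poly n) y → evalB B (signed I f) y ≈ sign I (evalB B f y)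
  evalB-signed B I f y with even (card I)
  ... | true  = evalB-neg B f y
  ... | false = refl

  even-suc : ∀ k → even (suc k) ≡ Bool.not (even k)
  even-suc zero    = ≡.refl
  even-suc (suc k) = ≡.sym (≡.trans (cong Bool.not (even-suc k)) (Bool.not-involutive (even k)))

  -- Adding or removing the first element pairs up the subsets with opposite signs.
  sumOver-sign : ∀ m c → sumOver (λ I → sign I c) (allSubsets (suc m)) ≈ 0#
  sumOver-sign m c = begin
    sumOver (λ I → sign I c) (map (true ∷_) A ++ map (false ∷_) A)
      ≈⟨ sumOver-++ _ (map (true ∷_) A) (map (false ∷_) A) ⟩
    sumOver (λ I → sign I c) (map (true ∷_) A) + sumOver (λ I → sign I c) (map (false ∷_) A)
      ≈⟨ +-cong (reflexive (sumOver-map _ (true ∷_) A)) (reflexive (sumOver-map _ (false ∷_) A)) ⟩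
    sumOver (λ I → sign (true ∷ I) c) A + sumOver (λ I → sign (false ∷ I) c) A
      ≈⟨ sumOver-+ _ _ A ⟨
    sumOver (λ I → sign (true ∷ I) c + sign (false ∷ I) c) A
      ≈⟨ sumOver-zero _ A (λ I → opposite (card I)) ⟩
    0# ∎
    where
    A = allSubsets m
    opposite : ∀ k → (if even (suc k) then - c else c) + (if even k then - c else c) ≈ 0#
    opposite k rewrite even-suc k with even k
    ... | true  = -‿inverseʳ c
    ... | false = -‿inverseˡ c

module FieldFacts {q : ℕ} (F : FiniteField q) where
  open FiniteField F
  open Polynomials cring using (_^ᴿ_; mono)
  open import Relation.Binary.Reasoning.Setoid setoid
  open import Algebra.Properties.Ring ring using (-‿distribˡ-*; x∙y⁻¹≈ε⇒x≈y)
  open MonoidSum *-commutativeMonoid using () renaming (sum to ∏; sum-cong-≋ to ∏-cong; sum-permute to ∏-permute; ∑-distrib-+ to ∏-distrib-*; sum-remove to ∏-remove)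
  import Data.Fin.Permutation as Permutation

  1≉0 : ¬ 1# ≈ 0#
  1≉0 = 0≉1 ∘ sym

  *-≉0 : ∀ {a b} → ¬ a ≈ 0# → ¬ b ≈ 0# → ¬ (a * b) ≈ 0#
  *-≉0 {a} {b} a≉0 b≉0 ab≈0 with inverse a a≉0
  ... | a⁻¹ , aa⁻¹≈1 = b≉0 (begin
    b               ≈⟨ *-identityˡ b ⟨
    1# * b          ≈⟨ *-congʳ (trans (sym aa⁻¹≈1) (*-comm a a⁻¹)) ⟩
    (a⁻¹ * a) * b   ≈⟨ *-assoc _ _ _ ⟩
    a⁻¹ * (a * b)   ≈⟨ *-congˡ ab≈0 ⟩
    a⁻¹ * 0#        ≈⟨ zeroʳ _ ⟩
    0#              ∎)

  ^ᴿ-≉0 : ∀ {a} k → ¬ a ≈ 0# → ¬ (a ^ᴿ k) ≈ 0#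
  ^ᴿ-≉0 zero    a≉0 = 1≉0
  ^ᴿ-≉0 (suc k) a≉0 = *-≉0 a≉0 (^ᴿ-≉0 k a≉0)

  mono-≉0 : ∀ {n} (y : Fin n → Carrier) (d : Exp n) → (∀ j → d j ≡ 0 ⊎ ¬ y j ≈ 0#) → ¬ mono y d ≈ 0#
  mono-≉0 {zero}  y d h = 1≉0
  mono-≉0 {suc n} y d h = *-≉0 head-≉0 (mono-≉0 (y ∘ suc) (d ∘ suc) (h ∘ suc))
    where
    head-≉0 : ¬ (y zero ^ᴿ d zero) ≈ 0#
    head-≉0 with h zero
    ... | inj₁ d≡0 rewrite d≡0 = 1≉0
    ... | inj₂ y≉0 = ^ᴿ-≉0 (d zero) y≉0

  *-≈0-cancelʳ : ∀ {a c} → ¬ c ≈ 0# → a * c ≈ 0# → a ≈ 0#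
  *-≈0-cancelʳ {a} c≉0 ac≈0 with a ≟ 0#
  ... | yes a≈0 = a≈0
  ... | no  a≉0 = ⊥-elim (*-≉0 a≉0 c≉0 ac≈0)

  *-cancelʳ : ∀ {a b c} → ¬ c ≈ 0# → a * c ≈ b * c → a ≈ b
  *-cancelʳ {a} {b} {c} c≉0 ac≈bc = x∙y⁻¹≈ε⇒x≈y a b (*-≈0-cancelʳ c≉0 (begin
    (a - b) * c       ≈⟨ distribʳ c a (- b) ⟩
    a * c + - b * c   ≈⟨ +-congˡ (-‿distribˡ-* b c) ⟨
    a * c - b * c     ≈⟨ +-congʳ ac≈bc ⟩
    b * c - b * c     ≈⟨ -‿inverseʳ _ ⟩
    0#                ∎))

  ∏-const : ∀ {n} (w : Fin n → Carrier) z → (∀ i → w i ≈ z) → ∏ w ≈ z ^ᴿ n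
  ∏-const {zero}  w z w≈z = refl
  ∏-const {suc n} w z w≈z = *-cong (w≈z zero) (∏-const (w ∘ suc) z (w≈z ∘ suc))

  ∏-const-except : ∀ {n} (w : Fin n → Carrier) z i₀ → w i₀ ≈ 1# → (∀ j → j ≢ i₀ → w j ≈ z) → ∏ w ≈ z ^ᴿ (n ℕ.∸ 1)
  ∏-const-except {suc n} w z i₀ w≈1 w≈z = begin
    ∏ w                               ≈⟨ ∏-remove {i = i₀} w ⟩
    w i₀ * ∏ (w ∘ Fin.punchIn i₀)     ≈⟨ *-cong w≈1 (∏-const _ z (λ j → w≈z _ (Fin.punchInᵢ≢i i₀ j))) ⟩
    1# * z ^ᴿ n                       ≈⟨ *-identityˡ _ ⟩
    z ^ᴿ n                            ∎

  nonzeroOr1 : Carrier → Carrier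
  nonzeroOr1 x with x ≟ 0#
  ... | yes _ = 1#
  ... | no  _ = x

  nonzeroOr1-≉0 : ∀ x → ¬ nonzeroOr1 x ≈ 0#
  nonzeroOr1-≉0 x with x ≟ 0#
  ... | yes _   = 1≉0
  ... | no  x≉0 = x≉0

  nonzeroOr1-cong : ∀ {x x′} → x ≈ x′ → nonzeroOr1 x ≈ nonzeroOr1 x′
  nonzeroOr1-cong {x} {x′} x≈x′ with x ≟ 0# | x′ ≟ 0#
  ... | yes _   | yes _    = refl
  ... | yes x≈0 | no  x′≉0 = ⊥-elim (x′≉0 (trans (sym x≈x′) x≈0))
  ... | no  x≉0 | yes x′≈0 = ⊥-elim (x≉0 (trans x≈x′ x′≈0))
  ... | no  _   | no  _    = x≈x′

  nonzeroOr1-* : ∀ z x → ¬ z ≈ 0# → nonzeroOr1 (z * x) ≈ (if does (x ≟ 0#) then 1# else z) * nonzeroOr1 x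
  nonzeroOr1-* z x z≉0 with x ≟ 0# | (z * x) ≟ 0#
  ... | yes _   | yes _     = sym (*-identityˡ 1#)
  ... | yes x≈0 | no  zx≉0 = ⊥-elim (zx≉0 (trans (*-congˡ x≈0) (zeroʳ z)))
  ... | no  x≉0 | yes zx≈0 = ⊥-elim (*-≉0 z≉0 x≉0 zx≈0)
  ... | no  _   | no  _     = refl

  index : Carrier → Fin q
  index x = proj₁ (elem-sur x)

  index-* : ∀ a b j → a * b ≈ 1# → index (a * elem (index (b * elem j))) ≡ j
  index-* a b j ab≈1 = elem-inj _ _ (begin
    elem (index (a * elem (index (b * elem j))))  ≈⟨ proj₂ (elem-sur _) ⟩
    a * elem (index (b * elem j))                 ≈⟨ *-congˡ (proj₂ (elem-sur _)) ⟩
    a * (b * elem j)                              ≈⟨ *-assoc _ _ _ ⟨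
    (a * b) * elem j                              ≈⟨ *-congʳ ab≈1 ⟩
    1# * elem j                                   ≈⟨ *-identityˡ _ ⟩
    elem j                                        ∎)

  scaling : ∀ z → ¬ z ≈ 0# → Permutation.Permutation q q
  scaling z z≉0 = Permutation.permutation (λ i → index (z * elem i)) (λ j → index (z⁻¹ * elem j))
    (λ j → index-* z z⁻¹ j zz⁻¹≈1) (λ i → index-* z⁻¹ z i (trans (*-comm _ _) zz⁻¹≈1))
    where
    z⁻¹ = proj₁ (inverse z z≉0)
    zz⁻¹≈1 = proj₂ (inverse z z≉0)

  ∏-≉0 : ∀ {n} (w : Fin n → Carrier) → (∀ i → ¬ w i ≈ 0#) → ¬ ∏ w ≈ 0#
  ∏-≉0 {zero}  w w≉0 = 1≉0
  ∏-≉0 {suc n} w w≉0 = *-≉0 (w≉0 zero) (∏-≉0 (w ∘ suc) (w≉0 ∘ suc))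

  -- Multiplication by z permutes the field, so it fixes ∏ (nonzeroOr1 ∘ elem); but it multiplies
  -- each of the q - 1 nonzero factors by z.
  x^[q-1]≈1 : ∀ z → ¬ z ≈ 0# → z ^ᴿ (q ℕ.∸ 1) ≈ 1#
  x^[q-1]≈1 z z≉0 = sym (*-cancelʳ (∏-≉0 f (nonzeroOr1-≉0 ∘ elem)) (begin
      1# * ∏ f                        ≈⟨ *-identityˡ _ ⟩
      ∏ f                             ≈⟨ ∏-permute f (scaling z z≉0) ⟩
      ∏ (λ i → f (index (z * elem i))) ≈⟨ ∏-cong (λ i → trans (nonzeroOr1-cong (proj₂ (elem-sur _))) (nonzeroOr1-* z (elem i) z≉0)) ⟩
      ∏ (λ i → w i * f i)             ≈⟨ ∏-distrib-* w f ⟩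
      ∏ w * ∏ f                       ≈⟨ *-congʳ (∏-const-except w z i₀ w-i₀ w-other) ⟩
      z ^ᴿ (q ℕ.∸ 1) * ∏ f            ∎))
    where
    f w : Fin q → Carrier
    f i = nonzeroOr1 (elem i)
    w i = if does (elem i ≟ 0#) then 1# else z
    i₀ : Fin q
    i₀ = index 0#
    w-i₀ : w i₀ ≈ 1#
    w-i₀ with elem i₀ ≟ 0#
    ... | yes _    = refl
    ... | no  i₀≉0 = ⊥-elim (i₀≉0 (proj₂ (elem-sur 0#)))
    w-other : ∀ j → j ≢ i₀ → w j ≈ z
    w-other j j≢i₀ with elem j ≟ 0#
    ... | yes j≈0 = ⊥-elim (j≢i₀ (elem-inj _ _ (trans j≈0 (sym (proj₂ (elem-sur 0#))))))
    ... | no  _   = refl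

module Subsets where
  open import Data.List.Membership.Propositional using (_∈_)
  open import Data.Nat using (_+_; _^_)

  ∈-allSubsets : ∀ {m} (I : Vec Bool m) → I ∈ allSubsets m
  ∈-allSubsets []          = here ≡.refl
  ∈-allSubsets (true ∷ I)  = Any.++⁺ˡ (Any.map⁺ (Any.map (cong (true ∷_)) (∈-allSubsets I)))
  ∈-allSubsets {suc m} (false ∷ I) = Any.++⁺ʳ (map (true ∷_) (allSubsets m)) (Any.map⁺ (Any.map (cong (false ∷_)) (∈-allSubsets I)))

  length-allSubsets : ∀ m → length (allSubsets m) ≡ 2 ^ m
  length-allSubsets zero    = ≡.refl
  length-allSubsets (suc m) = begin
    length (map (true ∷_) (allSubsets m) ++ map (false ∷_) (allSubsets m))
      ≡⟨ List.length-++ (map (true ∷_) (allSubsets m)) ⟩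
    length (map (true ∷_) (allSubsets m)) + length (map (false ∷_) (allSubsets m))
      ≡⟨ cong₂ _+_ (List.length-map _ (allSubsets m)) (List.length-map _ (allSubsets m)) ⟩
    length (allSubsets m) + length (allSubsets m)
      ≡⟨ cong₂ _+_ (length-allSubsets m) (length-allSubsets m) ⟩
    2 ^ m + 2 ^ m
      ≡⟨ cong (2 ^ m +_) (ℕ.+-identityʳ (2 ^ m)) ⟨
    2 ^ suc m ∎
    where open ≡.≡-Reasoning

module Support {q : ℕ} (F : FiniteField q) where
  open FiniteField F
  open Polynomials cring
  open Evaluation cring
  open FieldFacts F
  open import Relation.Binary.Reasoning.Setoid setoid
  open import Algebra.Properties.Ring ring using (+-cancelˡ)

  sumSelR-cong : ∀ {k} (I : Vec Bool k) {g g′ : Fin k → Carrier} → (∀ i → g i ≈ g′ i) → sumSelR F I g ≈ sumSelR F I g′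
  sumSelR-cong []          p = refl
  sumSelR-cong (true ∷ I)  p = +-cong (p zero) (sumSelR-cong I (p ∘ suc))
  sumSelR-cong (false ∷ I) p = sumSelR-cong I (p ∘ suc)

  evalB-sumSel* : ∀ {n k} B (I : Vec Bool k) (fs : Fin k → Poly n) (ys : Fin k → Carrier) (g : Poly n) y →
    (∀ i → evalB B (fs i *ₚ g) y ≈ ys i * evalB B g y) → evalB B (sumSel I fs *ₚ g) y ≈ sumSelR F I ys * evalB B g y
  evalB-sumSel* B []          fs ys g y h = trans (evalB-cong B y (*ₚ-zeroˡ g)) (trans (evalB-0ₚ B y) (sym (zeroˡ _)))
  evalB-sumSel* B (true ∷ I)  fs ys g y h = begin
    evalB B ((fs zero +ₚ sumSel I (fs ∘ suc)) *ₚ g) y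
      ≈⟨ evalB-cong B y (*ₚ-distribʳ (fs zero) _ g) ⟩
    evalB B ((fs zero *ₚ g) +ₚ (sumSel I (fs ∘ suc) *ₚ g)) y
      ≈⟨ evalB-+ₚ B _ _ y ⟩
    evalB B (fs zero *ₚ g) y + evalB B (sumSel I (fs ∘ suc) *ₚ g) y
      ≈⟨ +-cong (h zero) (evalB-sumSel* B I (fs ∘ suc) (ys ∘ suc) g y (h ∘ suc)) ⟩
    ys zero * evalB B g y + sumSelR F I (ys ∘ suc) * evalB B g y
      ≈⟨ distribʳ _ _ _ ⟨
    sumSelR F (true ∷ I) ys * evalB B g y ∎
  evalB-sumSel* B (false ∷ I) fs ys g y h = evalB-sumSel* B I (fs ∘ suc) (ys ∘ suc) g y (h ∘ suc)

  module _ (m : ℕ) where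

    evalB-xI+xp* : ∀ B I g y → Extensional g → ExponentsBelow B g →
      evalB B (xI+xp m I *ₚ g) y ≈ xI+xp-at F m I y * evalB B g y
    evalB-xI+xp* B I g y eg g-below = begin
      evalB B (xI+xp m I *ₚ g) y
        ≈⟨ evalB-cong B y (*ₚ-distribʳ _ _ g) ⟩
      evalB B ((sumSel I (X ∘ inject₁) *ₚ g) +ₚ (X (fromℕ m) *ₚ g)) y
        ≈⟨ evalB-+ₚ B _ _ y ⟩
      evalB B (sumSel I (X ∘ inject₁) *ₚ g) y + evalB B (X (fromℕ m) *ₚ g) y
        ≈⟨ +-cong (evalB-sumSel* B I _ _ g y (λ i → evalB-X* B (inject₁ i) g eg g-below y)) (evalB-X* B (fromℕ m) g eg g-below y) ⟩
      sumSelR F I (y ∘ inject₁) * evalB B g y + y (fromℕ m) * evalB B g y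
        ≈⟨ distribʳ _ _ _ ⟨
      xI+xp-at F m I y * evalB B g y ∎

    xI+xp*-exponentsBelow : ∀ B I g → Extensional g → ExponentsBelow B g → ExponentsBelow (suc B) (xI+xp m I *ₚ g)
    xI+xp*-exponentsBelow B I g eg g-below e i B<e =
      trans (*ₚ-distribʳ _ _ g e)
            (+ₚ-exponentsBelow (suc B) (sumSel*-exponentsBelow (suc B) I _ g (λ i′ → X*-exponentsBelow B (inject₁ i′) g eg g-below))
                                      (X*-exponentsBelow B (fromℕ m) g eg g-below) e i B<e)

    xI+xp^-exponentsBelow : ∀ I k → ExponentsBelow (suc k) (xI+xp m I ^ₚ k)
    xI+xp^-exponentsBelow I zero    = 1ₚ-exponentsBelow
    xI+xp^-exponentsBelow I (suc k) = xI+xp*-exponentsBelow (suc k) I _ (^ₚ-ext _ k) (xI+xp^-exponentsBelow I k)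

    evalB-xI+xp^ : ∀ B I k y → k ≤ B → evalB B (xI+xp m I ^ₚ k) y ≈ xI+xp-at F m I y ^ᴿ k
    evalB-xI+xp^ B I zero    y _   = evalB-1ₚ B y
    evalB-xI+xp^ B I (suc k) y k<B =
      trans (evalB-xI+xp* B I _ y (^ₚ-ext _ k) (ExponentsBelow-mono k<B (xI+xp^-exponentsBelow I k)))
            (*-congˡ (evalB-xI+xp^ B I k y (ℕ.<⇒≤ k<B)))

    numer-ext : Extensional (numer m q)
    numer-ext = Σₚ-ext _ (allSubsets m) (λ I → signed-ext I (^ₚ-ext (xI+xp m I) (q ℕ.∸ 1)))

    numer-exponentsBelow : 1 ≤ q → ExponentsBelow q (numer m q)
    numer-exponentsBelow 1≤q = Σₚ-exponentsBelow q _ (allSubsets m)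
      (λ I → signed-exponentsBelow q I (ExponentsBelow-mono (ℕ.≤-reflexive (ℕ.m+[n∸m]≡n 1≤q)) (xI+xp^-exponentsBelow I (q ℕ.∸ 1))))

    evalB-numer : ∀ y → evalB q (numer m q) y ≈ sumOver (λ I → sign I (xI+xp-at F m I y ^ᴿ (q ℕ.∸ 1))) (allSubsets m)
    evalB-numer y = trans (evalB-Σₚ q _ (allSubsets m) y)
      (sumOver-cong (allSubsets m) (λ I → trans (evalB-signed q I _ y) (sign-cong I (evalB-xI+xp^ q I (q ℕ.∸ 1) y (ℕ.m∸n≤m q 1)))))

  sumSelR-zeroAt : ∀ {k} (I : Vec Bool k) (i : Fin k) (g : Fin k → Carrier) →
    sumSelR F I (zeroAt i g) ≈ sumSelR F (I Vec.[ i ]≔ false) g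
  sumSelR-zeroAt (true ∷ I)  zero    g = +-identityˡ _
  sumSelR-zeroAt (false ∷ I) zero    g = refl
  sumSelR-zeroAt (true ∷ I)  (suc i) g = +-congˡ (sumSelR-zeroAt I i (g ∘ suc))
  sumSelR-zeroAt (false ∷ I) (suc i) g = sumSelR-zeroAt I i (g ∘ suc)

  zeroAt-inject₁-last : ∀ {m} (i : Fin m) (y : Fin (suc m) → Carrier) → zeroAt (inject₁ i) y (fromℕ m) ≡ y (fromℕ m)
  zeroAt-inject₁-last zero    y = ≡.refl
  zeroAt-inject₁-last (suc i) y = zeroAt-inject₁-last i (y ∘ suc)

  zeroAt-inject₁ : ∀ {m} (i i′ : Fin m) (y : Fin (suc m) → Carrier) →
    zeroAt (inject₁ i) y (inject₁ i′) ≡ zeroAt i (y ∘ inject₁) i′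
  zeroAt-inject₁ zero    zero     y = ≡.refl
  zeroAt-inject₁ zero    (suc i′) y = ≡.refl
  zeroAt-inject₁ (suc i) zero     y = ≡.refl
  zeroAt-inject₁ (suc i) (suc i′) y = zeroAt-inject₁ i i′ (y ∘ suc)

  xI+xp-at-zeroAt : ∀ {m} (I : Vec Bool m) (i : Fin m) y →
    xI+xp-at F m I (zeroAt (inject₁ i) y) ≈ xI+xp-at F m (I Vec.[ i ]≔ false) y
  xI+xp-at-zeroAt I i y =
    +-cong (trans (sumSelR-cong I (λ i′ → reflexive (zeroAt-inject₁ i i′ y))) (sumSelR-zeroAt I i _))
           (reflexive (zeroAt-inject₁-last i y))

  AllSumsNonzero : ∀ m → (Fin (suc m) → Carrier) → Set
  AllSumsNonzero m y = ∀ I → ¬ xI+xp-at F m I y ≈ 0#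

  toℕ<⇒inject₁ : ∀ {m} (j : Fin (suc m)) → toℕ j < m → Σ (Fin m) (λ i → inject₁ i ≡ j)
  toℕ<⇒inject₁ j j<m = Fin.lower₁ j (ℕ.>⇒≢ j<m) , Fin.inject₁-lower₁ j (ℕ.>⇒≢ j<m)

  AllSumsNonzero-zeroAt : ∀ m j y → toℕ j < m → AllSumsNonzero m y → AllSumsNonzero m (zeroAt j y)
  AllSumsNonzero-zeroAt m j y j<m nonzero I with toℕ<⇒inject₁ j j<m
  ... | i , ≡.refl = λ sum≈0 → nonzero (I Vec.[ i ]≔ false) (trans (sym (xI+xp-at-zeroAt I i y)) sum≈0)

  evalB-numer-≈0 : ∀ m y → AllSumsNonzero (suc m) y → evalB q (numer (suc m) q) y ≈ 0#
  evalB-numer-≈0 m y nonzero = begin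
    evalB q (numer (suc m) q) y
      ≈⟨ evalB-numer (suc m) y ⟩
    sumOver (λ I → sign I (xI+xp-at F (suc m) I y ^ᴿ (q ℕ.∸ 1))) (allSubsets (suc m))
      ≈⟨ sumOver-cong (allSubsets (suc m)) (λ I → sign-cong I (x^[q-1]≈1 _ (nonzero I))) ⟩
    sumOver (λ I → sign I 1#) (allSubsets (suc m))
      ≈⟨ sumOver-sign m 1# ⟩
    0# ∎

  P-at-≈0 : ∀ m (x : Fin (suc (suc m)) → Carrier) → (∀ i → ¬ x (inject₁ i) ≈ 0#) → AllSumsNonzero (suc m) x →
    P-at F (suc m) x ≈ 0#
  P-at-≈0 m x x≉0 nonzero = *-≈0-cancelʳ (mono-≉0 x (firstOnes (suc m)) firstOnes-≉0) (begin
    P-at F (suc m) x * mono x (firstOnes (suc m))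
      ≈⟨ evalAbove-shift q (numer (suc m) q) (numer-ext (suc m)) (ExponentsBelow-mono (ℕ.n≤1+n q) (numer-exponentsBelow (suc m) 1≤q)) _ x ⟨
    evalAbove q (numer (suc m) q) (firstOnes (suc m)) x
      ≈⟨ evalAbove-firstOnes q (numer (suc m) q) (AllSumsNonzero (suc m)) (ℕ.n≤1+n (suc m))
           (AllSumsNonzero-zeroAt (suc m)) (evalB-numer-≈0 m) (suc m) ℕ.≤-refl x nonzero ⟩
    0# ∎)
    where
    1≤q : 1 ≤ q
    1≤q with elem-sur 0#
    ... | zero  , _ = s≤s z≤n
    ... | suc _ , _ = s≤s z≤n
    firstOnes-≉0 : ∀ j → firstOnes (suc m) j ≡ 0 ⊎ ¬ x j ≈ 0#
    firstOnes-≉0 j with toℕ j ℕ.<ᵇ suc m in j<m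
    ... | false = inj₁ ≡.refl
    ... | true with toℕ<⇒inject₁ j (ℕ.<ᵇ⇒< (toℕ j) (suc m) (≡true⇒T j<m))
    ...   | i , ≡.refl = inj₂ (x≉0 i)

  support-⊆-hyperplanes : ∀ m → 1 ≤ m → ∀ x → ¬ P-at F m x ≈ 0# →
    (Σ (Fin m) λ i → x (inject₁ i) ≈ 0#) ⊎ (Σ (Vec Bool m) λ I → xI+xp-at F m I x ≈ 0#)
  support-⊆-hyperplanes (suc m) _ x P≉0 with Fin.any? (λ i → x (inject₁ i) ≟ 0#)
  ... | yes coordinate≈0 = inj₁ coordinate≈0
  ... | no  coordinates≉0 with Any.any? (λ I → xI+xp-at F (suc m) I x ≟ 0#) (allSubsets (suc m))
  ...   | yes sum≈0  = inj₂ (Any.satisfied sum≈0)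
  ...   | no  sums≉0 = ⊥-elim (P≉0 (P-at-≈0 m x (λ i xᵢ≈0 → coordinates≉0 (i , xᵢ≈0))
                                                (λ I sum≈0 → sums≉0 (Any.map (λ { ≡.refl → sum≈0 }) (Subsets.∈-allSubsets I)))))

  xI+xp-at-determines-last : ∀ {m} (I : Vec Bool m) y y′ → (∀ i → y (inject₁ i) ≈ y′ (inject₁ i)) →
    xI+xp-at F m I y ≈ 0# → xI+xp-at F m I y′ ≈ 0# → y (fromℕ m) ≈ y′ (fromℕ m)
  xI+xp-at-determines-last {m} I y y′ agree sum≈0 sum′≈0 = +-cancelˡ (sumSelR F I (y ∘ inject₁)) _ _ (begin
    sumSelR F I (y ∘ inject₁) + y (fromℕ m)     ≈⟨ sum≈0 ⟩
    0#                                          ≈⟨ sum′≈0 ⟨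
    sumSelR F I (y′ ∘ inject₁) + y′ (fromℕ m)   ≈⟨ +-congʳ (sumSelR-cong I agree) ⟨
    sumSelR F I (y ∘ inject₁) + y′ (fromℕ m)    ∎)

module SupportSize {q : ℕ} (F : FiniteField q) (m : ℕ) where
  open Counting
  open Support F
  open FiniteField F using (Carrier; _≈_; 0#; _≟_; elem; elem-inj; reflexive; trans; sym)
  open import Data.Nat.ListAction using () renaming (sum to sumᴸ)
  open import Data.Nat using (_+_; _*_; _^_)
  open ℕ.≤-Reasoning

  Hyperplane : Set
  Hyperplane = Fin m ⊎ Vec Bool m

  hyperplanes : List Hyperplane
  hyperplanes = map inj₁ (allFin m) ++ map inj₂ (allSubsets m)

  onHyperplane : Hyperplane → (Fin (suc m) → Fin q) → Bool
  onHyperplane (inj₁ i) v = does (elem (v (inject₁ i)) ≟ 0#)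
  onHyperplane (inj₂ I) v = does (xI+xp-at F m I (elem ∘ v) ≟ 0#)

  inSupport : (Fin (suc m) → Fin q) → Bool
  inSupport v = does (¬? (P-at F m (elem ∘ v) ≟ 0#))

  length-hyperplanes : length hyperplanes ≡ 2 ^ m + m
  length-hyperplanes = begin-equality
    length hyperplanes
      ≡⟨ List.length-++ (map inj₁ (allFin m)) ⟩
    length (map inj₁ (allFin m)) + length (map inj₂ (allSubsets m))
      ≡⟨ cong₂ _+_ (≡.trans (List.length-map inj₁ (allFin m)) (List.length-tabulate _))
                    (≡.trans (List.length-map inj₂ (allSubsets m)) (Subsets.length-allSubsets m)) ⟩
    m + 2 ^ m
      ≡⟨ ℕ.+-comm m _ ⟩
    2 ^ m + m ∎

  support-covered : 1 ≤ m → ∀ v → T (inSupport v) → Any (λ h → T (onHyperplane h v)) hyperplanes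
  support-covered 1≤m v v∈S with support-⊆-hyperplanes m 1≤m (elem ∘ v) (T-does⇒ (¬? (P-at F m (elem ∘ v) ≟ 0#)) v∈S)
  ... | inj₁ (i , vᵢ≈0)  = Any.++⁺ˡ (Any.map⁺ (Any.map (λ { ≡.refl → ⇒T-does (elem (v (inject₁ i)) ≟ 0#) vᵢ≈0 }) (∈-allFin i)))
  ... | inj₂ (I , sum≈0) = Any.++⁺ʳ (map inj₁ (allFin m)) (Any.map⁺ (Any.map (λ { ≡.refl → ⇒T-does (xI+xp-at F m I (elem ∘ v) ≟ 0#) sum≈0 }) (Subsets.∈-allSubsets I)))

  count-onHyperplane : ∀ h → count (onHyperplane h) (allFuns (suc m) q) ≤ q ^ m
  count-onHyperplane (inj₁ i) = count-allFuns-≤-determined m (inject₁ i) _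
    (λ v v′ _ vᵢ≈0 v′ᵢ≈0 → elem-inj _ _ (trans (T-does⇒ (_ ≟ 0#) vᵢ≈0) (sym (T-does⇒ (_ ≟ 0#) v′ᵢ≈0))))
  count-onHyperplane (inj₂ I) = count-allFuns-≤-determined m (fromℕ m) _
    (λ v v′ agree sum≈0 sum′≈0 → elem-inj _ _ (xI+xp-at-determines-last I (elem ∘ v) (elem ∘ v′)
      (λ i → reflexive (cong elem (agree (inject₁ i) (Fin.fromℕ≢inject₁ ∘ ≡.sym)))) (T-does⇒ (_ ≟ 0#) sum≈0) (T-does⇒ (_ ≟ 0#) sum′≈0)))

  supportSize-≤ : 1 ≤ m → supportSize F m ≤ (2 ^ m + m) * q ^ m
  supportSize-≤ 1≤m = begin
    supportSize F m
      ≡⟨ length-filter≡count _ (allFuns (suc m) q) ⟩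
    count inSupport (allFuns (suc m) q)
      ≤⟨ count-≤-sum-cover inSupport onHyperplane hyperplanes (support-covered 1≤m) (allFuns (suc m) q) ⟩
    sumᴸ (map (λ h → count (onHyperplane h) (allFuns (suc m) q)) hyperplanes)
      ≤⟨ sumᴸ-map-≤ _ count-onHyperplane hyperplanes ⟩
    length hyperplanes * q ^ m
      ≡⟨ cong (_* q ^ m) length-hyperplanes ⟩
    (2 ^ m + m) * q ^ m ∎

open import Data.Nat using (_+_; _*_; _^_)
open import Data.Nat.Primality using (Prime; prime⇒nonTrivial)

lemma3p5 : (m k q : ℕ) → Prime (suc m) → q ≡ suc m ^ k → (F : FiniteField q) →
    (supportSize F m ≤ (2 ^ m + m) * q ^ m)
    × ((x : Fin (suc m) → FiniteField.Carrier F) →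
        ¬ (FiniteField._≈_ F (P-at F m x) (FiniteField.0# F)) →
        (Σ (Fin m) (λ i → FiniteField._≈_ F (x (inject₁ i)) (FiniteField.0# F)))
        ⊎ (Σ (Vec Bool m) (λ I → FiniteField._≈_ F (xI+xp-at F m I x) (FiniteField.0# F))))
lemma3p5 m k q p-prime q≡p^k F = SupportSize.supportSize-≤ F m 1≤m , Support.support-⊆-hyperplanes F m 1≤m
  where
  1≤m : 1 ≤ m
  1≤m = ℕ.s≤s⁻¹ (ℕ.nonTrivial⇒n>1 (suc m) {{prime⇒nonTrivial p-prime}})
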